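{- Let $R_0$ be an order in an étale $\mathbb{Q}$-algebra and let $f\ge1$. For an overorder $R\supseteq R_0$ with $[R:R_0]=f$, set $I=fR$. Then $I\subseteq R_0$ is an $R_0$-submodule satisfying $fR_0\subseteq I\subseteq R_0$, $I^2\subseteq fI$, $[I:fR_0]=f$, and $R=\{x\in\frac1fR_0: fx\in I\}$. Conversely, every $R_0$-submodule $I$ with $fR_0\subseteq I\subseteq R_0$, $I^2\subseteq fI$ and $[I:fR_0]=f$ arises uniquely in this way from an overorder $R$ with $[R:R_0]=f$, via $I=fR$.
   Context: An overorder of $R_0$ is a subring $R$ of $R_0\otimes\mathbb{Q}$ containing $R_0$ with $R/R_0$ finite. -}

module Defs where

open import Level using (0ℓ)
open import Data.Nat as ℕ using (ℕ; zero; suc)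
open import Data.Integer as ℤ using (ℤ)
open import Data.Rational as ℚ using (ℚ; 0ℚ; 1ℚ; _+_; _*_; -_; _-_)
open import Data.Fin using (Fin)
open import Data.Vec using (Vec; tabulate; lookup; map; zipWith; replicate)
open import Data.List using (List; []; _∷_)
open import Data.Product using (Σ; ∃; _×_; _,_)
open import Relation.Binary.PropositionalEquality using (_≡_)
open import Relation.Unary using (Pred; _∈_; _⊆_)

sumFin : (n : ℕ) → (Fin n → ℚ) → ℚ
sumFin zero    g = 0ℚ
sumFin (suc n) g = g Fin.zero + sumFin n (λ i → g (Fin.suc i))
  where import Data.Fin as Fin

ℤ→ℚ : ℤ → ℚ
ℤ→ℚ z = z ℚ./ 1

ℕ→ℚ : ℕ → ℚ
ℕ→ℚ m = ℤ.+ m ℚ./ 1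

-- The ambient ℚ-algebra R₀ ⊗ ℚ = ℚⁿ, with multiplication given by
-- integral structure constants c i j k w.r.t. a ℤ-basis of R₀.
V : ℕ → Set
V n = Vec ℚ n

module _ {n : ℕ} where
  _⊕_ : V n → V n → V n
  _⊕_ = zipWith _+_

  _⊖_ : V n → V n → V n
  _⊖_ = zipWith _-_

  ⊝_ : V n → V n
  ⊝_ = map (-_)

  𝟘 : V n
  𝟘 = replicate n 0ℚ

  _•_ : ℕ → V n → V n
  m • x = map (ℕ→ℚ m *_) x

  _•ℚ_ : ℚ → V n → V n
  q •ℚ x = map (q *_) x

  mulWith : (Fin n → Fin n → Fin n → ℤ) → V n → V n → V n
  mulWith c x y = tabulate λ k →
    sumFin n λ i → sumFin n λ j → (lookup x i * lookup y j) * ℤ→ℚ (c i j k)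

  powWith : (Fin n → Fin n → Fin n → ℤ) → V n → V n → ℕ → V n
  powWith c e x zero    = e
  powWith c e x (suc m) = mulWith c x (powWith c e x m)

-- An order R₀ of rank n in an étale ℚ-algebra, presented through a
-- ℤ-basis: R₀ = ℤⁿ ⊆ ℚⁿ = R₀ ⊗ ℚ, with integral structure constants.
-- The ℚ-algebra ℚⁿ is commutative, associative, unital (unit in R₀),
-- and étale, i.e. (characteristic 0) reduced: no nonzero nilpotents.
record Order (n : ℕ) : Set where
  field
    c    : Fin n → Fin n → Fin n → ℤ
    one  : Vec ℤ n
  _·_ : V n → V n → V n
  _·_ = mulWith c
  𝟙 : V n
  𝟙 = map ℤ→ℚ one
  field
    ·-comm     : ∀ x y → x · y ≡ y · x
    ·-assoc    : ∀ x y z → (x · y) · z ≡ x · (y · z)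
    ·-identity : ∀ x → 𝟙 · x ≡ x
    reduced    : ∀ x m → powWith c 𝟙 x (suc m) ≡ 𝟘 → x ≡ 𝟘

module OrderTheory {n : ℕ} (O : Order n) where
  open Order O public

  R₀ : Pred (V n) 0ℓ
  R₀ x = ∀ i → ∃ λ z → lookup x i ≡ ℤ→ℚ z

  record IsSubring (R : Pred (V n) 0ℓ) : Set where
    field
      has-𝟙 : 𝟙 ∈ R
      has-𝟘 : 𝟘 ∈ R
      ⊕-closed : ∀ {x y} → x ∈ R → y ∈ R → (x ⊕ y) ∈ R
      ⊝-closed : ∀ {x} → x ∈ R → (⊝ x) ∈ R
      ·-closed : ∀ {x y} → x ∈ R → y ∈ R → (x · y) ∈ R

  -- [A : B] = f : the quotient A/B has exactly f elements, witnessed by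
  -- f coset representatives (pairwise inequivalent, exhaustive).
  Index : Pred (V n) 0ℓ → Pred (V n) 0ℓ → ℕ → Set
  Index A B f = Σ (Fin f → V n) λ r →
      (∀ i → r i ∈ A)
    × (∀ i j → (r i ⊖ r j) ∈ B → i ≡ j)
    × (∀ a → a ∈ A → ∃ λ i → (a ⊖ r i) ∈ B)

  record IsOverorder (R : Pred (V n) 0ℓ) : Set where
    field
      subring : IsSubring R
      ⊇R₀     : R₀ ⊆ R
      finite  : ∃ λ m → Index R R₀ m

  record IsSubmodule (I : Pred (V n) 0ℓ) : Set where
    field
      has-𝟘 : 𝟘 ∈ I
      ⊕-closed : ∀ {x y} → x ∈ I → y ∈ I → (x ⊕ y) ∈ I
      ⊝-closed : ∀ {x} → x ∈ I → (⊝ x) ∈ I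
      R₀-closed : ∀ {r x} → r ∈ R₀ → x ∈ I → (r · x) ∈ I

  scale : ℕ → Pred (V n) 0ℓ → Pred (V n) 0ℓ
  scale m A x = ∃ λ a → a ∈ A × x ≡ m • a

  invScale : ℕ → Pred (V n) 0ℓ → Pred (V n) 0ℓ
  invScale m A x = (m • x) ∈ A

  sumL : List (V n) → V n
  sumL []       = 𝟘
  sumL (v ∷ vs) = v ⊕ sumL vs

  -- I² : the additive group generated by products a·b with a, b ∈ I
  -- (finite sums of such products; negation is absorbed since I = -I,
  --  and the empty sum gives 0)
  data Prods (I : Pred (V n) 0ℓ) : List (V n) → Set where
    []  : Prods I []
    _∷_ : ∀ {a b vs} → (a ∈ I × b ∈ I) → Prods I vs → Prods I ((a · b) ∷ vs)

  sq : Pred (V n) 0ℓ → Pred (V n) 0ℓ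
  sq I x = ∃ λ vs → Prods I vs × x ≡ sumL vs

  _≐_ : Pred (V n) 0ℓ → Pred (V n) 0ℓ → Set
  A ≐ B = (A ⊆ B) × (B ⊆ A)

-- If [R : R₀] = f, then f annihilates R/R₀: translation by x ∈ R permutes the f cosets, so
-- f x is the sum over the coset representatives rᵢ of the integral vectors rᵢ + x − r_{σ i}.
-- Hence I = fR ⊆ R₀ and I² = f²R² ⊆ f(fR). The rest is bookkeeping with the mutually
-- inverse maps A ↦ fA and A ↦ (1/f)A = {x : fx ∈ A}: both preserve indices, and for the
-- converse R = (1/f)I is closed under products exactly because I² ⊆ fI.
module Submission where

open import Defs
open import Level using (0ℓ)
open import Function using (_∘_; _⟨_⟩_)
open import Data.Nat as ℕ using (ℕ; zero; suc; _≤_)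
open import Data.Integer as ℤ using (ℤ)
import Data.Integer.Properties as ℤ
import Data.Nat.Coprimality as Coprime
open import Data.Rational as ℚ using (ℚ; mkℚ; 0ℚ; 1ℚ; _+_; _*_; -_; _-_; 1/_; NonZero)
import Data.Rational.Properties as ℚ
open import Data.Rational.Solver using (module +-*-Solver)
open import Data.Fin as Fin using (Fin)
open import Data.Fin.Permutation using (Permutation′; permutation; _⟨$⟩ʳ_)
open import Data.Vec using ([]; _∷_; lookup)
import Data.Vec.Properties as Vec
open import Data.List using ([]; _∷_)
open import Data.Product using (∃; _×_; _,_; proj₁; proj₂)
open import Relation.Unary using (Pred; _∈_; _⊆_)
open import Relation.Unary.Properties using (≐-sym; ≐-trans)
open import Relation.Binary.PropositionalEquality
open import Algebra.Properties.CommutativeMonoid.Sum ℚ.+-0-commutativeMonoid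
  using (sum; sum-cong-≗; ∑-distrib-+; sum-permute)

open +-*-Solver

Integral : ℚ → Set
Integral q = ∃ λ z → q ≡ ℤ→ℚ z

-- ℤ→ℚ normalises through gcd, which is stuck on variables; this normal form computes.
ℤ→ℚ-normal : ℤ → ℚ
ℤ→ℚ-normal z = mkℚ z 0 (Coprime.sym (Coprime.1-coprimeTo _))

ℤ→ℚ≡normal : ∀ z → ℤ→ℚ z ≡ ℤ→ℚ-normal z
ℤ→ℚ≡normal z = ℚ.↥p/↧p≡p (ℤ→ℚ-normal z)

ℤ→ℚ-homo-+ : ∀ z w → ℤ→ℚ (z ℤ.+ w) ≡ ℤ→ℚ z + ℤ→ℚ w
ℤ→ℚ-homo-+ z w = begin
  (z ℤ.+ w) ℚ./ 1                      ≡⟨ cong (ℚ._/ 1) (sym (cong₂ ℤ._+_ (ℤ.*-identityʳ z) (ℤ.*-identityʳ w))) ⟩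
  (z ℤ.* ℤ.+ 1 ℤ.+ w ℤ.* ℤ.+ 1) ℚ./ 1  ≡⟨ sym (cong₂ _+_ (ℤ→ℚ≡normal z) (ℤ→ℚ≡normal w)) ⟩
  ℤ→ℚ z + ℤ→ℚ w                        ∎
  where open ≡-Reasoning

ℕ→ℚ-suc : ∀ m → ℕ→ℚ (suc m) ≡ 1ℚ + ℕ→ℚ m
ℕ→ℚ-suc m = ℤ→ℚ-homo-+ (ℤ.+ 1) (ℤ.+ m)

ℕ→ℚ-nonZero : ∀ m .{{_ : ℕ.NonZero m}} → NonZero (ℕ→ℚ m)
ℕ→ℚ-nonZero (suc k) = ℚ.pos⇒nonZero (ℕ→ℚ (suc k)) {{ℚ.normalize-pos (suc k) 1}}

integral-+ : ∀ {p q} → Integral p → Integral q → Integral (p + q)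
integral-+ (z , refl) (w , refl) = z ℤ.+ w , sym (ℤ→ℚ-homo-+ z w)

integral-sum : ∀ {m} {g : Fin m → ℚ} → (∀ i → Integral (g i)) → Integral (sum g)
integral-sum {zero}  _     = ℤ.+ 0 , refl
integral-sum {suc m} int-g = integral-+ (int-g Fin.zero) (integral-sum (int-g ∘ Fin.suc))

sum-const : ∀ m c → sum {m} (λ _ → c) ≡ ℕ→ℚ m * c
sum-const zero    c = sym (ℚ.*-zeroˡ c)
sum-const (suc m) c = begin
  c + sum {m} (λ _ → c)    ≡⟨ cong (c +_) (sum-const m c) ⟩
  c + ℕ→ℚ m * c            ≡⟨ solve 2 (λ c x → c :+ x :* c := (con 1ℚ :+ x) :* c) refl c (ℕ→ℚ m) ⟩
  (1ℚ + ℕ→ℚ m) * c         ≡⟨ cong (_* c) (sym (ℕ→ℚ-suc m)) ⟩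
  ℕ→ℚ (suc m) * c          ∎
  where open ≡-Reasoning

sum-neg : ∀ {m} (g : Fin m → ℚ) → sum (λ i → - g i) ≡ - sum g
sum-neg {zero}  g = refl
sum-neg {suc m} g = trans (cong (- g Fin.zero +_) (sum-neg (g ∘ Fin.suc)))
                          (sym (ℚ.neg-distrib-+ (g Fin.zero) _))

sum-translate-permute : ∀ {m} (g : Fin m → ℚ) (π : Permutation′ m) c →
                        sum (λ i → (g i + c) - g (π ⟨$⟩ʳ i)) ≡ ℕ→ℚ m * c
sum-translate-permute {m} g π c = begin
  sum (λ i → (g i + c) - g (π ⟨$⟩ʳ i))
    ≡⟨ sum-cong-≗ (λ i → regroup (g i) c (g (π ⟨$⟩ʳ i))) ⟩
  sum (λ i → (g i + - g (π ⟨$⟩ʳ i)) + c)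
    ≡⟨ ∑-distrib-+ (λ i → g i + - g (π ⟨$⟩ʳ i)) c̄ ⟩
  sum (λ i → g i + - g (π ⟨$⟩ʳ i)) + sum c̄
    ≡⟨ cong (_+ sum c̄) (∑-distrib-+ g (λ i → - g (π ⟨$⟩ʳ i))) ⟩
  (sum g + sum (λ i → - g (π ⟨$⟩ʳ i))) + sum c̄
    ≡⟨ cong (λ t → (sum g + t) + sum c̄) (sum-neg (g ∘ (π ⟨$⟩ʳ_))) ⟩
  (sum g - sum (g ∘ (π ⟨$⟩ʳ_))) + sum c̄
    ≡⟨ cong (λ t → (sum g - t) + sum c̄) (sym (sum-permute g π)) ⟩
  (sum g - sum g) + sum c̄
    ≡⟨ cong (_+ sum c̄) (ℚ.+-inverseʳ (sum g)) ⟩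
  0ℚ + sum c̄
    ≡⟨ ℚ.+-identityˡ (sum c̄) ⟩
  sum c̄
    ≡⟨ sum-const m c ⟩
  ℕ→ℚ m * c
    ∎
  where
  open ≡-Reasoning
  c̄ : Fin m → ℚ
  c̄ _ = c
  regroup : ∀ a c b → (a + c) - b ≡ (a + - b) + c
  regroup = solve 3 (λ a c b → (a :+ c) :- b := (a :+ :- b) :+ c) refl

•ℚ-distrib-⊕ : ∀ {n} q (x y : V n) → q •ℚ (x ⊕ y) ≡ (q •ℚ x) ⊕ (q •ℚ y)
•ℚ-distrib-⊕ q []      []      = refl
•ℚ-distrib-⊕ q (a ∷ x) (b ∷ y) = cong₂ _∷_ (ℚ.*-distribˡ-+ q a b) (•ℚ-distrib-⊕ q x y)

•ℚ-distrib-⊝ : ∀ {n} q (x : V n) → q •ℚ (⊝ x) ≡ ⊝ (q •ℚ x)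
•ℚ-distrib-⊝ q []      = refl
•ℚ-distrib-⊝ q (a ∷ x) = cong₂ _∷_ (sym (ℚ.neg-distribʳ-* q a)) (•ℚ-distrib-⊝ q x)

•ℚ-distrib-⊖ : ∀ {n} q (x y : V n) → q •ℚ (x ⊖ y) ≡ (q •ℚ x) ⊖ (q •ℚ y)
•ℚ-distrib-⊖ q []      []      = refl
•ℚ-distrib-⊖ q (a ∷ x) (b ∷ y) = cong₂ _∷_ (distrib q a b) (•ℚ-distrib-⊖ q x y)
  where
  distrib : ∀ q a b → q * (a - b) ≡ q * a - q * b
  distrib = solve 3 (λ q a b → q :* (a :- b) := q :* a :- q :* b) refl

•ℚ-zeroʳ : ∀ {n} q → q •ℚ 𝟘 {n} ≡ 𝟘
•ℚ-zeroʳ {zero}  q = refl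
•ℚ-zeroʳ {suc n} q = cong₂ _∷_ (ℚ.*-zeroʳ q) (•ℚ-zeroʳ q)

•ℚ-assoc : ∀ {n} p q (x : V n) → p •ℚ (q •ℚ x) ≡ (p * q) •ℚ x
•ℚ-assoc p q []      = refl
•ℚ-assoc p q (a ∷ x) = cong₂ _∷_ (sym (ℚ.*-assoc p q a)) (•ℚ-assoc p q x)

•ℚ-identityˡ : ∀ {n} (x : V n) → 1ℚ •ℚ x ≡ x
•ℚ-identityˡ []      = refl
•ℚ-identityˡ (a ∷ x) = cong₂ _∷_ (ℚ.*-identityˡ a) (•ℚ-identityˡ x)

•ℚ-inverseˡ : ∀ {n} q .{{_ : NonZero q}} (x : V n) → (1/ q) •ℚ (q •ℚ x) ≡ x
•ℚ-inverseˡ q x = trans (•ℚ-assoc (1/ q) q x)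
  (trans (cong (_•ℚ x) (ℚ.*-inverseˡ q)) (•ℚ-identityˡ x))

•ℚ-inverseʳ : ∀ {n} q .{{_ : NonZero q}} (x : V n) → q •ℚ ((1/ q) •ℚ x) ≡ x
•ℚ-inverseʳ q x = trans (•ℚ-assoc q (1/ q) x)
  (trans (cong (_•ℚ x) (ℚ.*-inverseʳ q)) (•ℚ-identityˡ x))

•ℚ-cancelˡ : ∀ {n} q .{{_ : NonZero q}} {x y : V n} → q •ℚ x ≡ q •ℚ y → x ≡ y
•ℚ-cancelˡ q {x} {y} eq = begin
  x                     ≡⟨ sym (•ℚ-inverseˡ q x) ⟩
  (1/ q) •ℚ (q •ℚ x)    ≡⟨ cong ((1/ q) •ℚ_) eq ⟩
  (1/ q) •ℚ (q •ℚ y)    ≡⟨ •ℚ-inverseˡ q y ⟩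
  y                     ∎
  where open ≡-Reasoning

⊕-identityʳ : ∀ {n} (x : V n) → x ⊕ 𝟘 ≡ x
⊕-identityʳ []      = refl
⊕-identityʳ (a ∷ x) = cong₂ _∷_ (ℚ.+-identityʳ a) (⊕-identityʳ x)

⊕-inverseˡ : ∀ {n} (x : V n) → (⊝ x) ⊕ x ≡ 𝟘
⊕-inverseˡ []      = refl
⊕-inverseˡ (a ∷ x) = cong₂ _∷_ (ℚ.+-inverseˡ a) (⊕-inverseˡ x)

⊕-inverseʳ : ∀ {n} (x : V n) → x ⊕ (⊝ x) ≡ 𝟘
⊕-inverseʳ []      = refl
⊕-inverseʳ (a ∷ x) = cong₂ _∷_ (ℚ.+-inverseʳ a) (⊕-inverseʳ x)

⊖-telescope : ∀ {n} (a b c y z : V n) → ((a ⊕ y) ⊖ b) ⊕ ((b ⊕ z) ⊖ c) ≡ (a ⊖ c) ⊕ (y ⊕ z)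
⊖-telescope []      []      []      []      []      = refl
⊖-telescope (a ∷ as) (b ∷ bs) (c ∷ cs) (y ∷ ys) (z ∷ zs) =
  cong₂ _∷_ (telescope a b c y z) (⊖-telescope as bs cs ys zs)
  where
  telescope : ∀ a b c y z → ((a + y) - b) + ((b + z) - c) ≡ (a - c) + (y + z)
  telescope = solve 5 (λ a b c y z → ((a :+ y) :- b) :+ ((b :+ z) :- c) := (a :- c) :+ (y :+ z)) refl

lookup-⊕-⊖ : ∀ {n} (a x b : V n) i → lookup ((a ⊕ x) ⊖ b) i ≡ (lookup a i + lookup x i) - lookup b i
lookup-⊕-⊖ a x b i = trans (Vec.lookup-zipWith _-_ i (a ⊕ x) b)
                           (cong (_- lookup b i) (Vec.lookup-zipWith _+_ i a x))

sumFin-scale : ∀ n q {g h : Fin n → ℚ} → (∀ i → g i ≡ q * h i) → sumFin n g ≡ q * sumFin n h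
sumFin-scale zero    q _    = sym (ℚ.*-zeroʳ q)
sumFin-scale (suc n) q g≡qh = trans (cong₂ _+_ (g≡qh Fin.zero) (sumFin-scale n q (g≡qh ∘ Fin.suc)))
                                    (sym (ℚ.*-distribˡ-+ q _ _))

mulWith-•ℚˡ : ∀ {n} c q (x y : V n) → mulWith c (q •ℚ x) y ≡ q •ℚ mulWith c x y
mulWith-•ℚˡ {n} c q x y = trans (Vec.tabulate-cong λ k →
    sumFin-scale n q λ i → sumFin-scale n q λ j → reassoc (lookup-map i) (lookup y j) (ℤ→ℚ (c i j k)))
  (Vec.tabulate-∘ (q *_) _)
  where
  lookup-map : ∀ i → lookup (q •ℚ x) i ≡ q * lookup x i
  lookup-map i = Vec.lookup-map i (q *_) x
  reassoc : ∀ {a b} → a ≡ q * b → ∀ d e → (a * d) * e ≡ q * ((b * d) * e)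
  reassoc {b = b} refl d e = trans (cong (_* e) (ℚ.*-assoc q b d)) (ℚ.*-assoc q (b * d) e)

module Overorders {n : ℕ} (O : Order n) where
  open OrderTheory O

  Closed₁ : (V n → V n) → Pred (V n) 0ℓ → Set
  Closed₁ _◃ A = ∀ {x} → x ∈ A → (x ◃) ∈ A

  Closed₂ : (V n → V n → V n) → Pred (V n) 0ℓ → Set
  Closed₂ _◃_ A = ∀ {x y} → x ∈ A → y ∈ A → (x ◃ y) ∈ A

  R₀-⊕-closed : Closed₂ _⊕_ R₀
  R₀-⊕-closed {x} {y} x∈R₀ y∈R₀ i =
    subst Integral (sym (Vec.lookup-zipWith _+_ i x y)) (integral-+ (x∈R₀ i) (y∈R₀ i))

  𝟙∈R₀ : 𝟙 ∈ R₀
  𝟙∈R₀ i = lookup one i , Vec.lookup-map i ℤ→ℚ one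

  ·-•ℚˡ : ∀ q x y → (q •ℚ x) · y ≡ q •ℚ (x · y)
  ·-•ℚˡ = mulWith-•ℚˡ c

  ·-•ℚʳ : ∀ q x y → x · (q •ℚ y) ≡ q •ℚ (x · y)
  ·-•ℚʳ q x y = trans (·-comm x (q •ℚ y)) (trans (·-•ℚˡ q y x) (cong (q •ℚ_) (·-comm y x)))

  •-·-• : ∀ m x y → (m • x) · (m • y) ≡ m • (m • (x · y))
  •-·-• m x y = trans (·-•ℚˡ (ℕ→ℚ m) x (m • y)) (cong (m •_) (·-•ℚʳ (ℕ→ℚ m) x y))

  index⇒•∈R₀ : ∀ {A m} → Closed₂ _⊕_ A → Closed₁ ⊝_ A → Index A R₀ m →
               ∀ {x} → x ∈ A → (m • x) ∈ R₀
  index⇒•∈R₀ {A} {m} ⊕-closed ⊝-closed (r , r∈A , distinct , exhaustive) {x} x∈A l =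
    subst Integral (sym m•x≡sum) (integral-sum (λ i → shift-spec x∈A i l))
    where
    shift : ∀ {y} → y ∈ A → Fin m → Fin m
    shift y∈A i = proj₁ (exhaustive _ (⊕-closed (r∈A i) y∈A))

    shift-spec : ∀ {y} (y∈A : y ∈ A) i → ((r i ⊕ y) ⊖ r (shift y∈A i)) ∈ R₀
    shift-spec y∈A i = proj₂ (exhaustive _ (⊕-closed (r∈A i) y∈A))

    shift-inverse : ∀ {y z} (y∈A : y ∈ A) (z∈A : z ∈ A) → y ⊕ z ≡ 𝟘 →
                    ∀ i → shift z∈A (shift y∈A i) ≡ i
    shift-inverse {y} {z} y∈A z∈A y⊕z≡𝟘 i = sym (distinct i k (subst R₀ telescope
      (R₀-⊕-closed {(r i ⊕ y) ⊖ r j} (shift-spec y∈A i) (shift-spec z∈A j))))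
      where
      j k : Fin m
      j = shift y∈A i
      k = shift z∈A j
      telescope : ((r i ⊕ y) ⊖ r j) ⊕ ((r j ⊕ z) ⊖ r k) ≡ r i ⊖ r k
      telescope = trans (⊖-telescope (r i) (r j) (r k) y z)
                        (trans (cong ((r i ⊖ r k) ⊕_) y⊕z≡𝟘) (⊕-identityʳ (r i ⊖ r k)))

    π : Permutation′ m
    π = permutation (shift x∈A) (shift (⊝-closed x∈A))
          (shift-inverse (⊝-closed x∈A) x∈A (⊕-inverseˡ x))
          (shift-inverse x∈A (⊝-closed x∈A) (⊕-inverseʳ x))

    m•x≡sum : lookup (m • x) l ≡ sum (λ i → lookup ((r i ⊕ x) ⊖ r (π ⟨$⟩ʳ i)) l)
    m•x≡sum = begin
      lookup (m • x) l
        ≡⟨ Vec.lookup-map l (ℕ→ℚ m *_) x ⟩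
      ℕ→ℚ m * lookup x l
        ≡⟨ sym (sum-translate-permute (λ i → lookup (r i) l) π (lookup x l)) ⟩
      sum (λ i → (lookup (r i) l + lookup x l) - lookup (r (π ⟨$⟩ʳ i)) l)
        ≡⟨ sum-cong-≗ (λ i → sym (lookup-⊕-⊖ (r i) x (r (π ⟨$⟩ʳ i)) l)) ⟩
      sum (λ i → lookup ((r i ⊕ x) ⊖ r (π ⟨$⟩ʳ i)) l)
        ∎
      where open ≡-Reasoning

  scale-mono : ∀ {m A B} → A ⊆ B → scale m A ⊆ scale m B
  scale-mono A⊆B (a , a∈A , eq) = a , A⊆B a∈A , eq

  scale-𝟘 : ∀ {m A} → 𝟘 ∈ A → 𝟘 ∈ scale m A
  scale-𝟘 {m} 𝟘∈A = 𝟘 , 𝟘∈A , sym (•ℚ-zeroʳ (ℕ→ℚ m))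

  scale-⊕-closed : ∀ {m A} → Closed₂ _⊕_ A → Closed₂ _⊕_ (scale m A)
  scale-⊕-closed {m} ⊕-closed (a , a∈A , refl) (b , b∈A , refl) =
    a ⊕ b , ⊕-closed a∈A b∈A , sym (•ℚ-distrib-⊕ (ℕ→ℚ m) a b)

  scale-⊝-closed : ∀ {m A} → Closed₁ ⊝_ A → Closed₁ ⊝_ (scale m A)
  scale-⊝-closed {m} ⊝-closed (a , a∈A , refl) = ⊝ a , ⊝-closed a∈A , sym (•ℚ-distrib-⊝ (ℕ→ℚ m) a)

  scale-isSubmodule : ∀ {m R} → IsSubring R → R₀ ⊆ R → IsSubmodule (scale m R)
  scale-isSubmodule {m} {R} R-subring R₀⊆R = record
    { has-𝟘     = scale-𝟘 {m} {R} has-𝟘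
    ; ⊕-closed  = scale-⊕-closed {m} {R} ⊕-closed
    ; ⊝-closed  = scale-⊝-closed {m} {R} ⊝-closed
    ; R₀-closed = λ { {s} s∈R₀ (a , a∈R , refl) → s · a , ·-closed {s} (R₀⊆R s∈R₀) a∈R , ·-•ℚʳ (ℕ→ℚ m) s a }
    }
    where open IsSubring R-subring

  sq-least : ∀ {I J} → 𝟘 ∈ J → Closed₂ _⊕_ J → (∀ {a b} → a ∈ I → b ∈ I → (a · b) ∈ J) → sq I ⊆ J
  sq-least {I} {J} 𝟘∈J ⊕-closed ·∈J (vs , products , refl) = sumL∈J products
    where
    sumL∈J : ∀ {vs} → Prods I vs → sumL vs ∈ J
    sumL∈J []                      = 𝟘∈J
    sumL∈J ((a∈I , b∈I) ∷ products) = ⊕-closed (·∈J a∈I b∈I) (sumL∈J products)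

  ·∈sq : ∀ {I a b} → a ∈ I → b ∈ I → (a · b) ∈ sq I
  ·∈sq {a = a} {b} a∈I b∈I = (a · b) ∷ [] , (a∈I , b∈I) ∷ [] , sym (⊕-identityʳ (a · b))

  sq-scale : ∀ {m R} → IsSubring R → sq (scale m R) ⊆ scale m (scale m R)
  sq-scale {m} {R} R-subring =
    sq-least (scale-𝟘 {m} {scale m R} (scale-𝟘 {m} {R} has-𝟘))
             (scale-⊕-closed {m} {scale m R} (scale-⊕-closed {m} {R} ⊕-closed))
    λ { (a , a∈R , refl) (b , b∈R , refl) → m • (a · b) , (a · b , ·-closed a∈R b∈R , refl) , •-·-• m a b }
    where open IsSubring R-subring

  invScale-𝟘 : ∀ {m A} → 𝟘 ∈ A → 𝟘 ∈ invScale m A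
  invScale-𝟘 {m} {A} 𝟘∈A = subst A (sym (•ℚ-zeroʳ (ℕ→ℚ m))) 𝟘∈A

  invScale-⊕-closed : ∀ {m A} → Closed₂ _⊕_ A → Closed₂ _⊕_ (invScale m A)
  invScale-⊕-closed {m} {A} ⊕-closed {x} {y} mx∈A my∈A =
    subst A (sym (•ℚ-distrib-⊕ (ℕ→ℚ m) x y)) (⊕-closed mx∈A my∈A)

  invScale-⊝-closed : ∀ {m A} → Closed₁ ⊝_ A → Closed₁ ⊝_ (invScale m A)
  invScale-⊝-closed {m} {A} ⊝-closed {x} mx∈A = subst A (sym (•ℚ-distrib-⊝ (ℕ→ℚ m) x)) (⊝-closed mx∈A)

  scale⊆⇒⊆invScale : ∀ {m A B} → scale m A ⊆ B → A ⊆ invScale m B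
  scale⊆⇒⊆invScale mA⊆B a∈A = mA⊆B (_ , a∈A , refl)

  Index-respʳ-≐ : ∀ {A B B′ m} → B ≐ B′ → Index A B m → Index A B′ m
  Index-respʳ-≐ (B⊆B′ , B′⊆B) (r , r∈A , distinct , exhaustive) =
    r , r∈A , (λ i j → distinct i j ∘ B′⊆B)
      , (λ a a∈A → let (i , a-rᵢ∈B) = exhaustive a a∈A in i , B⊆B′ a-rᵢ∈B)

  index⇒scale⊆R₀ : ∀ {R m} → IsSubring R → Index R R₀ m → scale m R ⊆ R₀
  index⇒scale⊆R₀ R-subring R-index (_ , a∈R , refl) = index⇒•∈R₀ ⊕-closed ⊝-closed R-index a∈R
    where open IsSubring R-subring

  module _ (m : ℕ) .{{_ : ℕ.NonZero m}} where
    private instance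
      m-nonZero : NonZero (ℕ→ℚ m)
      m-nonZero = ℕ→ℚ-nonZero m

    unscale : V n → V n
    unscale x = (1/ ℕ→ℚ m) •ℚ x

    •-unscale : ∀ x → m • unscale x ≡ x
    •-unscale = •ℚ-inverseʳ (ℕ→ℚ m)

    •-cancelˡ : ∀ {x y : V n} → m • x ≡ m • y → x ≡ y
    •-cancelˡ = •ℚ-cancelˡ (ℕ→ℚ m)

    invScale-scale : ∀ {B} → invScale m (scale m B) ≐ B
    invScale-scale {B} = (λ (b , b∈B , mx≡mb) → subst B (sym (•-cancelˡ mx≡mb)) b∈B)
                       , (λ b∈B → _ , b∈B , refl)

    scale-invScale : ∀ {A} → scale m (invScale m A) ≐ A
    scale-invScale {A} = (λ (a , ma∈A , y≡ma) → subst A (sym y≡ma) ma∈A)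
                       , (λ {y} y∈A → unscale y , subst A (sym (•-unscale y)) y∈A , sym (•-unscale y))

    scale⊆scale⇒⊆ : ∀ {A B} → scale m A ⊆ scale m B → A ⊆ B
    scale⊆scale⇒⊆ mA⊆mB a∈A = proj₁ invScale-scale (mA⊆mB (_ , a∈A , refl))

    scale-injective : ∀ {A B} → scale m A ≐ scale m B → A ≐ B
    scale-injective (mA⊆mB , mB⊆mA) = scale⊆scale⇒⊆ mA⊆mB , scale⊆scale⇒⊆ mB⊆mA

    Index-scale : ∀ {A B k} → Index A B k → Index (scale m A) (scale m B) k
    Index-scale {A} {B} (r , r∈A , distinct , exhaustive) =
        (λ i → m • r i)
      , (λ i → r i , r∈A i , refl)
      , (λ i j (b , b∈B , mrᵢ-mrⱼ≡mb) → distinct i j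
           (subst B (sym (•-cancelˡ (trans (•ℚ-distrib-⊖ (ℕ→ℚ m) (r i) (r j)) mrᵢ-mrⱼ≡mb))) b∈B))
      , (λ { _ (a , a∈A , refl) → let (i , a-rᵢ∈B) = exhaustive a a∈A in
               i , a ⊖ r i , a-rᵢ∈B , sym (•ℚ-distrib-⊖ (ℕ→ℚ m) a (r i)) })

    Index-invScale : ∀ {A B k} → Index A B k → Index (invScale m A) (invScale m B) k
    Index-invScale {A} {B} (r , r∈A , distinct , exhaustive) =
        (λ i → unscale (r i))
      , (λ i → subst A (sym (•-unscale (r i))) (r∈A i))
      , (λ i j p → distinct i j (subst B (•-⊖-unscale (unscale (r i)) (r j) ⟨ trans ⟩
                                           cong (_⊖ r j) (•-unscale (r i))) p))
      , (λ x mx∈A → let (i , mx-rᵢ∈B) = exhaustive (m • x) mx∈A in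
           i , subst B (sym (•-⊖-unscale x (r i))) mx-rᵢ∈B)
      where
      •-⊖-unscale : ∀ x y → m • (x ⊖ unscale y) ≡ (m • x) ⊖ y
      •-⊖-unscale x y = trans (•ℚ-distrib-⊖ (ℕ→ℚ m) x (unscale y)) (cong ((m • x) ⊖_) (•-unscale y))

    invScale-·-closed : ∀ {I} → sq I ⊆ scale m I → Closed₂ _·_ (invScale m I)
    invScale-·-closed {I} sq⊆mI {x} {y} mx∈I my∈I =
      let (z , z∈I , mx·my≡mz) = sq⊆mI (·∈sq {I} mx∈I my∈I)
      in subst I (sym (•-cancelˡ (trans (sym (•-·-• m x y)) mx·my≡mz))) z∈I

    ideal⇒overorder : ∀ {I} → IsSubmodule I → scale m R₀ ⊆ I → sq I ⊆ scale m I →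
                      Index I (scale m R₀) m →
                      ∃ λ R → IsOverorder R × Index R R₀ m × (I ≐ scale m R)
    ideal⇒overorder {I} I-submodule mR₀⊆I sq⊆mI I-index =
      invScale m I , R-overorder , R-index , ≐-sym (scale-invScale {I})
      where
      open IsSubmodule I-submodule
      R-index : Index (invScale m I) R₀ m
      R-index = Index-respʳ-≐ (invScale-scale {R₀}) (Index-invScale {I} {scale m R₀} I-index)
      R-overorder : IsOverorder (invScale m I)
      R-overorder = record
        { subring = record
          { has-𝟙    = scale⊆⇒⊆invScale {m} mR₀⊆I 𝟙∈R₀
          ; has-𝟘    = invScale-𝟘 {m} {I} has-𝟘
          ; ⊕-closed = invScale-⊕-closed {m} {I} ⊕-closed
          ; ⊝-closed = invScale-⊝-closed {m} {I} ⊝-closed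
          ; ·-closed = invScale-·-closed sq⊆mI
          }
        ; ⊇R₀    = scale⊆⇒⊆invScale {m} mR₀⊆I
        ; finite = m , R-index
        }

    overorder≐invScale : ∀ {R} → IsSubring R → Index R R₀ m →
                         R ≐ (λ x → x ∈ invScale m R₀ × (m • x) ∈ scale m R)
    overorder≐invScale {R} R-subring R-index =
        (λ x∈R → index⇒•∈R₀ ⊕-closed ⊝-closed R-index x∈R , _ , x∈R , refl)
      , (λ (_ , mx∈mR) → proj₁ (invScale-scale {R}) mx∈mR)
      where open IsSubring R-subring

mainTheorem9 : ∀ {n : ℕ} (O : Order n) (f : ℕ) → 1 ≤ f →
    let open OrderTheory O in
      (∀ (R : Pred (V n) 0ℓ) → IsOverorder R → Index R R₀ f →
        IsSubmodule (scale f R)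
        × (scale f R₀ ⊆ scale f R) × (scale f R ⊆ R₀)
        × (sq (scale f R) ⊆ scale f (scale f R))
        × Index (scale f R) (scale f R₀) f
        × (R ≐ (λ x → x ∈ invScale f R₀ × (f • x) ∈ scale f R)))
    × (∀ (I : Pred (V n) 0ℓ) → IsSubmodule I
        → scale f R₀ ⊆ I → I ⊆ R₀
        → sq I ⊆ scale f I
        → Index I (scale f R₀) f
        → (∃ λ (R : Pred (V n) 0ℓ) → IsOverorder R × Index R R₀ f × (I ≐ scale f R))
          × (∀ (R R′ : Pred (V n) 0ℓ)
               → IsOverorder R → Index R R₀ f → I ≐ scale f R
               → IsOverorder R′ → Index R′ R₀ f → I ≐ scale f R′
               → R ≐ R′))
mainTheorem9 O f@(suc _) _ =
    (λ R R-overorder R-index → let open IsOverorder R-overorder in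
        scale-isSubmodule {f} subring ⊇R₀
      , scale-mono {f} ⊇R₀
      , index⇒scale⊆R₀ subring R-index
      , sq-scale {f} subring
      , Index-scale f R-index
      , overorder≐invScale f subring R-index)
  , (λ I I-submodule fR₀⊆I _ sq⊆fI I-index →
        ideal⇒overorder f I-submodule fR₀⊆I sq⊆fI I-index
      , λ R R′ _ _ I≐fR _ _ I≐fR′ → scale-injective f (≐-trans (≐-sym I≐fR) I≐fR′))
  where
  open OrderTheory O
  open Overorders O
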